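{- For a generalised multi-clause-set $F$ the following are equivalent: (1) $F$ is matching lean; (2) for every clause $C$ occurring in $F$, $\delta^*(F-\{C\})<\delta^*(F)$; (3) for every $F'\le F$ with $F'\neq F$, $\delta(F')<\delta(F)$; (4) $F$ is a tight sub-multi-clause-set of itself, and $F$ has no other tight sub-multi-clause-sets.
   Context: Each variable $v$ has a finite non-empty domain $D_v$; a literal is a pair $(v,\varepsilon)$, $\varepsilon\in D_v$, meaning "$v\ne\varepsilon$"; a clause is a finite set of literals with no two distinct literals on the same variable; a multi-clause-set $F$ is a finitely supported map from clauses to $\mathbb{N}_0$; $F'\le F$ pointwise; $F-\{C\}$ removes one occurrence of $C$. $c(F)=\sum_CF(C)$, $\mathrm{rd}(F)=\sum_{v\in\mathrm{var}(F)}(|D_v|-1)$, $\delta(F)=c(F)-\mathrm{rd}(F)$, $\delta^*(F)=\max_{F'\le F}\delta(F')$. $F'\le F$ is tight (for $F$) if $\delta(F')=\delta^*(F)$. $B(F)$: bipartite graph with clause-nodes $(C,i)$, $1\le i\le F(C)$, variable-nodes $(v,j)$, $v\in\mathrm{var}(F)$, $1\le j\le|D_v|-1$, adjacent iff $v\in\mathrm{var}(C)$; for a partial assignment $\varphi$ (map from finitely many variables to values), $B_\varphi(F)$ keeps only the edges where $\varphi$ satisfies the literal of $C$ on $v$ (i.e. $v\in\mathrm{var}(\varphi)$ and $\varphi(v)\neq$ that literal's value). $\varphi$ is matching-satisfying for $F$ iff $B_\varphi(F)$ has a matching covering all clause-nodes. $\varphi$ is a matching autarky for $F$ if it is matching-satisfying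 for the sub-multi-clause-set $F_{\mathrm{var}(\varphi)}$ of all clause occurrences $C$ with $\mathrm{var}(C)\cap\mathrm{var}(\varphi)\ne\emptyset$; it is non-trivial iff $\mathrm{var}(\varphi)\cap\mathrm{var}(F)\ne\emptyset$. $F$ is matching lean iff it has no non-trivial matching autarky. -}

module Defs where

open import Data.Nat using (ℕ; zero; suc; _≤_; _<ᵇ_; _≡ᵇ_; _≟_)
open import Data.Integer as ℤ using (ℤ; +_; _-_; _⊔_)
open import Data.Bool using (Bool; true; false; _∧_; _∨_; T; if_then_else_)
open import Data.Unit using (tt)
open import Data.Bool.Properties using (T-irrelevant)
open import Data.Nat.ListAction using (sum)
open import Data.Bool.ListAction using (any)
open import Data.List using (List; []; _∷_; map; length; lookup; concatMap; deduplicate; filterᵇ; _++_; foldr)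
import Data.List.Properties as LP
import Data.Product.Properties as PP
open import Data.List.Membership.Propositional using (_∈_)
open import Data.Product using (_×_; _,_; proj₁; proj₂; Σ; ∃; ∃-syntax)
open import Data.Fin using (Fin)
open import Function.Definitions using (Injective)
open import Relation.Binary.PropositionalEquality using (_≡_; _≢_; refl; cong)
open import Relation.Binary.Definitions using (DecidableEquality)
open import Relation.Nullary using (¬_; yes; no)

-- The domains are given by a function
-- D : ℕ → ℕ with  |D_v| = suc (D v)  (so every domain is finite and
-- non-empty, and D_v = {0, …, D v}); hence  |D_v| - 1 = D v.

module _ (D : ℕ → ℕ) where

  wfᵇ : List (ℕ × ℕ) → Bool
  wfᵇ [] = true
  wfᵇ ((v , e) ∷ []) = e <ᵇ suc (D v)
  wfᵇ ((v , e) ∷ (w , f) ∷ xs) = (e <ᵇ suc (D v)) ∧ (v <ᵇ w) ∧ wfᵇ ((w , f) ∷ xs)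

  -- A finite set of literals/assignments, no two on the same variable,
  -- canonically represented as a list sorted strictly by variable.
  record FinMap : Set where
    constructor mk
    field
      lits : List (ℕ × ℕ)
      wf   : T (wfᵇ lits)
  open FinMap public

  -- A clause: the pair (v , ε) in lits is the literal  "v ≠ ε".
  Clause : Set
  Clause = FinMap

  -- A partial assignment: the pair (v , a) in lits means  v ↦ a.
  PAss : Set
  PAss = FinMap

  _≟ᶜ_ : DecidableEquality FinMap
  mk l p ≟ᶜ mk l' p' with LP.≡-dec (PP.≡-dec _≟_ _≟_) l l'
  ... | no ne = no (λ { refl → ne refl })
  mk l p ≟ᶜ mk .l p' | yes refl = yes (cong (mk l) (T-irrelevant p p'))

  varFM : FinMap → List ℕ
  varFM X = map proj₁ (lits X)

  -- Multi-clause-sets: finite lists of clauses, read up to permutation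
  -- (the multiplicity of C is  count C).
  MCS : Set
  MCS = List Clause

  mult : MCS → Clause → ℕ
  mult [] C = 0
  mult (X ∷ F) C with C ≟ᶜ X
  ... | yes _ = suc (mult F C)
  ... | no  _ = mult F C

  _≤ₘ_ : MCS → MCS → Set
  F' ≤ₘ F = ∀ C → mult F' C ≤ mult F C

  _≈ₘ_ : MCS → MCS → Set
  F' ≈ₘ F = ∀ C → mult F' C ≡ mult F C

  remove1 : Clause → MCS → MCS
  remove1 C [] = []
  remove1 C (X ∷ F) with C ≟ᶜ X
  ... | yes _ = F
  ... | no  _ = X ∷ remove1 C F

  var : MCS → List ℕ
  var F = deduplicate _≟_ (concatMap varFM F)

  c : MCS → ℕ
  c F = length F

  rd : MCS → ℕ
  rd F = sum (map D (var F))

  δ : MCS → ℤ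
  δ F = + c F - + rd F

  subs : MCS → List MCS
  subs [] = [] ∷ []
  subs (X ∷ F) = subs F ++ map (X ∷_) (subs F)

  -- δ*(F) = max { δ(F') | F' ≤ F }   (the empty F' gives δ = 0)
  δ* : MCS → ℤ
  δ* F = foldr _⊔_ (+ 0) (map δ (subs F))

  Tight : MCS → MCS → Set
  Tight F F' = F' ≤ₘ F × δ F' ≡ δ* F

  -- Matchings in B_φ(F)
  -- variable node (v , j), 1 ≤ j ≤ |D_v| - 1 = D v; the edge from clause C
  -- to (v , j) is kept iff φ satisfies the literal of C on v.
  Edgeφ : PAss → Clause → ℕ × ℕ → Set
  Edgeφ φ C (v , j) =
    1 ≤ j × j ≤ D v ×
    ∃[ a ] ∃[ b ] ((v , a) ∈ lits φ × (v , b) ∈ lits C × a ≢ b)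

  -- B_φ(F) has a matching covering all clause-nodes (clause-nodes are the
  -- occurrences, i.e. the positions of the list F)
  MatchingSatisfying : PAss → MCS → Set
  MatchingSatisfying φ F =
    Σ (Fin (length F) → ℕ × ℕ) λ m →
      Injective _≡_ _≡_ m × (∀ i → Edgeφ φ (lookup F i) (m i))

  memᵇ : ℕ → List ℕ → Bool
  memᵇ v [] = false
  memᵇ v (w ∷ ws) = (v ≡ᵇ w) ∨ memᵇ v ws

  restrict : PAss → MCS → MCS
  restrict φ F = filterᵇ (λ C → any (λ v → memᵇ v (varFM φ)) (varFM C)) F

  MatchingAutarky : PAss → MCS → Set
  MatchingAutarky φ F = MatchingSatisfying φ (restrict φ F)

  NonTrivial : PAss → MCS → Set
  NonTrivial φ F = ∃[ v ] (v ∈ varFM φ × v ∈ var F)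

  MatchingLean : MCS → Set
  MatchingLean F = ¬ (∃[ φ ] (MatchingAutarky φ F × NonTrivial φ F))

module Submission where

-- Write δ for the deficiency; (2) and (4) are reformulations of (3), "every proper
-- sub-multi-clause-set has smaller deficiency", through δ* = max δ.
-- A non-trivial matching autarky φ violates (3): removing the clauses touched by φ leaves a
-- proper F' with δ(F') ≥ δ(F), because the matching injects the removed clauses into the
-- variable nodes of var(φ) ∩ var(F), and these variables no longer occur in F'.
-- Conversely, let G < F with δ(G) ≥ δ(F). If Hall's condition holds for the clauses of F − G
-- against the nodes of the variables of F not in G, a Hall matching yields a non-trivial
-- matching autarky: each new variable gets a value satisfying the literals of the clauses
-- matched to it, of which there are at most |D_v| − 1. Otherwise a violating set S can be
-- added to G, which strictly increases δ(G); since G grows inside F, this terminates.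

open import Data.Bool using (Bool; true; false; _∧_; _∨_; not; if_then_else_; T)
open import Data.Bool.ListAction using (any)
open import Data.Bool.Properties using (∨-zeroʳ; ∨-assoc; ∨-identityʳ; ∧-zeroʳ; ∧-conicalˡ; ∧-conicalʳ; T-≡; T-∧)
open import Data.Empty using (⊥-elim)
open import Data.Fin as Fin using (Fin)
open import Data.Fin.Properties using (injective⇒≤)
open import Data.Integer as ℤ using (ℤ; _⊔_)
import Data.Integer.Properties as ℤ
open import Data.List using (List; []; _∷_; _++_; map; length; filterᵇ; upTo; applyUpTo; lookup; foldr; concatMap)
open import Data.List.Properties using (length-++; length-map; length-upTo; length-applyUpTo; map-∘; map-id; foldr-forcesᵇ)
open import Data.List.Membership.Propositional using (_∈_; _∉_; find; lose)
open import Data.List.Membership.Propositional.Properties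
  using (∈-upTo⁺; ∈-upTo⁻; ∈-++⁺ˡ; ∈-++⁺ʳ; ∈-++⁻; ∈-map⁺; ∈-map⁻; ∈-concatMap⁺; ∈-concatMap⁻;
         ∈-applyUpTo⁺; ∈-applyUpTo⁻; ∈-deduplicate⁺; ∈-deduplicate⁻; ∈-lookup; foldr-selective)
open import Data.List.Relation.Binary.Disjoint.Propositional using (Disjoint)
open import Data.List.Relation.Binary.Pointwise using (Pointwise; []; _∷_)
open import Data.List.Relation.Binary.Sublist.Propositional using (_⊆_; []; _∷_; _∷ʳ_; minimum; ⊆-trans; from∈)
open import Data.List.Relation.Binary.Sublist.Propositional.Properties using (length-mono-≤)
open import Data.List.Relation.Unary.All using (All; []; _∷_)
import Data.List.Relation.Unary.All as All
open import Data.List.Relation.Unary.All.Properties using (All¬⇒¬Any; ¬Any⇒All¬; ¬All⇒Any¬)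
open import Data.List.Relation.Unary.AllPairs using (AllPairs)
import Data.List.Relation.Unary.AllPairs.Properties as AllPairs
open import Data.List.Relation.Unary.Any using (Any; here; there; _─_)
import Data.List.Relation.Unary.Any as Any
open import Data.List.Relation.Unary.Any.Properties using (lookup-index)
open import Data.List.Relation.Unary.Unique.Propositional using (Unique; []; _∷_)
import Data.List.Relation.Unary.Unique.Propositional.Properties as Unique
open import Data.Nat using (ℕ; zero; suc; _+_; _∸_; _≤_; _<_; z≤n; s≤s; _≤?_; _<?_; _≟_; _≡ᵇ_)
open import Data.Nat.ListAction using (sum)
open import Data.Nat.Properties
open import Algebra.Properties.CommutativeSemigroup +-commutativeSemigroup using (x∙yz≈y∙xz)
open import Data.List.Membership.DecPropositional _≟_ using (_∈?_)
open import Data.List.Relation.Unary.Unique.DecPropositional.Properties _≟_ using (deduplicate-!)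
open import Data.Product using (_×_; _,_; proj₁; proj₂; ∃-syntax; map₁; map₂)
import Data.Product.Properties as ×
open import Data.Sum using (_⊎_; inj₁; inj₂; [_,_]′)
import Data.Sum as Sum
open import Function using (_∘_)
open import Function.Bundles using (_⇔_; mk⇔; Equivalence)
open import Function.Definitions using (Injective)
open import Relation.Binary.Definitions using (DecidableEquality)
open import Relation.Binary.PropositionalEquality
  using (_≡_; _≢_; refl; sym; trans; cong; cong₂; subst; subst₂; module ≡-Reasoning)
open import Relation.Nullary using (¬_; Dec; yes; no; does; _×-dec_)
open import Relation.Nullary.Decidable using (T?)
open import Defs

module _ {A : Set} where

  sumWhere : (A → ℕ) → (A → Bool) → List A → ℕ
  sumWhere w P [] = 0
  sumWhere w P (x ∷ xs) = if P x then w x + sumWhere w P xs else sumWhere w P xs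

  count : (A → Bool) → List A → ℕ
  count = sumWhere (λ _ → 1)

  ∈-filterᵇ⁻ : (P : A → Bool) (xs : List A) {z : A} → z ∈ filterᵇ P xs → z ∈ xs × P z ≡ true
  ∈-filterᵇ⁻ P (x ∷ xs) p with P x in eq
  ∈-filterᵇ⁻ P (x ∷ xs) (here refl) | true = here refl , eq
  ∈-filterᵇ⁻ P (x ∷ xs) (there p) | true = map₁ there (∈-filterᵇ⁻ P xs p)
  ... | false = map₁ there (∈-filterᵇ⁻ P xs p)

  ∈-filterᵇ⁺ : (P : A → Bool) (xs : List A) {z : A} → z ∈ xs → P z ≡ true → z ∈ filterᵇ P xs
  ∈-filterᵇ⁺ P (x ∷ xs) (here refl) e rewrite e = here refl
  ∈-filterᵇ⁺ P (x ∷ xs) (there p) e with P x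
  ... | true = there (∈-filterᵇ⁺ P xs p e)
  ... | false = ∈-filterᵇ⁺ P xs p e

  length-filterᵇ-not : (P : A → Bool) (xs : List A) →
    length (filterᵇ P xs) + length (filterᵇ (not ∘ P) xs) ≡ length xs
  length-filterᵇ-not P [] = refl
  length-filterᵇ-not P (x ∷ xs) with P x
  ... | true = cong suc (length-filterᵇ-not P xs)
  ... | false = trans (+-suc _ _) (cong suc (length-filterᵇ-not P xs))

  sum-map-filterᵇ : (w : A → ℕ) (P : A → Bool) (xs : List A) →
    sum (map w (filterᵇ P xs)) ≡ sumWhere w P xs
  sum-map-filterᵇ w P [] = refl
  sum-map-filterᵇ w P (x ∷ xs) with P x
  ... | true = cong (w x +_) (sum-map-filterᵇ w P xs)
  ... | false = sum-map-filterᵇ w P xs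

  sumWhere-cong : (w : A → ℕ) (P Q : A → Bool) (xs : List A) →
    (∀ x → x ∈ xs → P x ≡ Q x) → sumWhere w P xs ≡ sumWhere w Q xs
  sumWhere-cong w P Q [] h = refl
  sumWhere-cong w P Q (x ∷ xs) h rewrite h x (here refl) with Q x
  ... | true = cong (w x +_) (sumWhere-cong w P Q xs (λ y p → h y (there p)))
  ... | false = sumWhere-cong w P Q xs (λ y p → h y (there p))

  sumWhere-mono : (w : A → ℕ) (P Q : A → Bool) (xs : List A) →
    (∀ x → x ∈ xs → P x ≡ true → Q x ≡ true) → sumWhere w P xs ≤ sumWhere w Q xs
  sumWhere-mono w P Q [] h = z≤n
  sumWhere-mono w P Q (x ∷ xs) h with P x in eP | Q x in eQ
  ... | true | true = +-monoʳ-≤ (w x) (sumWhere-mono w P Q xs (λ y p → h y (there p)))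
  ... | true | false with () ← trans (sym (h x (here refl) eP)) eQ
  ... | false | true = ≤-trans (sumWhere-mono w P Q xs (λ y p → h y (there p))) (m≤n+m _ (w x))
  ... | false | false = sumWhere-mono w P Q xs (λ y p → h y (there p))

  sumWhere-∨ : (w : A → ℕ) (P Q : A → Bool) (xs : List A) →
    sumWhere w (λ x → P x ∨ Q x) xs ≡ sumWhere w P xs + sumWhere w (λ x → not (P x) ∧ Q x) xs
  sumWhere-∨ w P Q [] = refl
  sumWhere-∨ w P Q (x ∷ xs) with P x | Q x
  ... | true | _ = trans (cong (w x +_) (sumWhere-∨ w P Q xs)) (sym (+-assoc (w x) _ _))
  ... | false | true = trans (cong (w x +_) (sumWhere-∨ w P Q xs)) (x∙yz≈y∙xz (w x) (sumWhere w P xs) _)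
  ... | false | false = sumWhere-∨ w P Q xs

  sumWhere-filterᵇ : (w : A → ℕ) (Q P : A → Bool) (xs : List A) →
    sumWhere w P (filterᵇ Q xs) ≡ sumWhere w (λ x → Q x ∧ P x) xs
  sumWhere-filterᵇ w Q P [] = refl
  sumWhere-filterᵇ w Q P (x ∷ xs) with Q x
  ... | false = sumWhere-filterᵇ w Q P xs
  ... | true with P x
  ...   | true = cong (w x +_) (sumWhere-filterᵇ w Q P xs)
  ...   | false = sumWhere-filterᵇ w Q P xs

  sumWhere-∷ : (w : A → ℕ) (P : A → Bool) (x : A) (xs : List A) →
    sumWhere w P (x ∷ xs) ≡ (if P x then w x else 0) + sumWhere w P xs
  sumWhere-∷ w P x xs with P x
  ... | true = refl
  ... | false = refl

  sumWhere-++ : (w : A → ℕ) (P : A → Bool) (xs ys : List A) →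
    sumWhere w P (xs ++ ys) ≡ sumWhere w P xs + sumWhere w P ys
  sumWhere-++ w P [] ys = refl
  sumWhere-++ w P (x ∷ xs) ys with P x
  ... | true = trans (cong (w x +_) (sumWhere-++ w P xs ys)) (sym (+-assoc (w x) _ _))
  ... | false = sumWhere-++ w P xs ys

  sumWhere-positive : (w : A → ℕ) (P : A → Bool) (xs : List A) → 0 < sumWhere w P xs →
    ∃[ x ] (x ∈ xs × P x ≡ true × 0 < w x)
  sumWhere-positive w P (x ∷ xs) h with P x in eP | w x in ew
  ... | true | suc _ = x , here refl , eP , subst (0 <_) (sym ew) (s≤s z≤n)
  ... | true | zero = map₂ (map₁ there) (sumWhere-positive w P xs h)
  ... | false | _ = map₂ (map₁ there) (sumWhere-positive w P xs h)

  sum-map-─ : (w : A → ℕ) {x : A} (ys : List A) (p : x ∈ ys) →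
    sum (map w ys) ≡ w x + sum (map w (ys ─ p))
  sum-map-─ w (y ∷ ys) (here refl) = refl
  sum-map-─ w {x} (y ∷ ys) (there p) =
    trans (cong (w y +_) (sum-map-─ w ys p)) (x∙yz≈y∙xz (w y) (w x) _)

  ∈-─ : {x z : A} (ys : List A) (p : x ∈ ys) → z ∈ ys → z ≢ x → z ∈ (ys ─ p)
  ∈-─ (y ∷ ys) (here refl) (here refl) z≢x = ⊥-elim (z≢x refl)
  ∈-─ (y ∷ ys) (here refl) (there q) z≢x = q
  ∈-─ (y ∷ ys) (there p) (here refl) z≢x = here refl
  ∈-─ (y ∷ ys) (there p) (there q) z≢x = there (∈-─ ys p q z≢x)

  Unique-sum-mono : (w : A → ℕ) {xs ys : List A} → Unique xs → (∀ {z} → z ∈ xs → z ∈ ys) →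
    sum (map w xs) ≤ sum (map w ys)
  Unique-sum-mono w {[]} _ _ = z≤n
  Unique-sum-mono w {x ∷ xs} {ys} (x≢xs ∷ xs!) xs⊆ys = begin
    w x + sum (map w xs)        ≤⟨ +-monoʳ-≤ (w x) (Unique-sum-mono w xs! xs⊆ys─x) ⟩
    w x + sum (map w (ys ─ x∈)) ≡⟨ sym (sum-map-─ w ys x∈) ⟩
    sum (map w ys)              ∎
    where
    open ≤-Reasoning
    x∈ = xs⊆ys (here refl)
    xs⊆ys─x : ∀ {z} → z ∈ xs → z ∈ (ys ─ x∈)
    xs⊆ys─x z∈ = ∈-─ ys x∈ (xs⊆ys (there z∈)) (All.lookup x≢xs z∈ ∘ sym)

  Unique-length-mono : {xs ys : List A} → Unique xs → (∀ {z} → z ∈ xs → z ∈ ys) →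
    length xs ≤ length ys
  Unique-length-mono {xs} {ys} xs! xs⊆ys =
    subst₂ _≤_ (sum-map-const xs) (sum-map-const ys) (Unique-sum-mono (λ _ → 1) xs! xs⊆ys)
    where
    sum-map-const : (zs : List A) → sum (map (λ _ → 1) zs) ≡ length zs
    sum-map-const [] = refl
    sum-map-const (_ ∷ zs) = cong suc (sum-map-const zs)

module _ {A : Set} (_≟_ : DecidableEquality A) where

  without : A → List A → List A
  without n = filterᵇ (λ m → not (does (m ≟ n)))

  ∉-without : (n : A) (U : List A) → n ∉ without n U
  ∉-without n U n∈ with n ≟ n | proj₂ (∈-filterᵇ⁻ _ U n∈)
  ... | yes _ | ()
  ... | no n≢n | _ = n≢n refl

  ∈-without⁻ : (n : A) (U : List A) {z : A} → z ∈ without n U → z ∈ U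
  ∈-without⁻ n U = proj₁ ∘ ∈-filterᵇ⁻ _ U

  without-∉ : {n : A} (U : List A) → n ∉ U → without n U ≡ U
  without-∉ [] _ = refl
  without-∉ {n} (m ∷ U) n∉ with m ≟ n
  ... | yes refl = ⊥-elim (n∉ (here refl))
  ... | no _ = cong (m ∷_) (without-∉ U (n∉ ∘ there))

  count-without : (P : A → Bool) (n : A) {U : List A} → Unique U → count P U ≤ suc (count P (without n U))
  count-without P n {[]} [] = z≤n
  count-without P n {m ∷ U} (m≢U ∷ U!) with m ≟ n
  ... | yes refl rewrite without-∉ U (All¬⇒¬Any m≢U) with P m
  ...   | true = ≤-refl
  ...   | false = n≤1+n _
  count-without P n {m ∷ U} (_ ∷ U!) | no _ with P m
  ... | true = s≤s (count-without P n U!)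
  ... | false = count-without P n U!

unused-value : (n : ℕ) (bs : List ℕ) → length bs ≤ n → ∃[ a ] (a ≤ n × a ∉ bs)
unused-value n bs bs≤n with All.all? (_∈? bs) (upTo (suc n))
... | yes all∈ = ⊥-elim (<⇒≱ (s≤s bs≤n) (begin
      suc n                  ≡⟨ sym (length-upTo (suc n)) ⟩
      length (upTo (suc n))  ≤⟨ Unique-length-mono (Unique.upTo⁺ (suc n)) (All.lookup all∈) ⟩
      length bs              ∎))
  where open ≤-Reasoning
... | no ¬all∈ with find (¬All⇒Any¬ (_∈? bs) (upTo (suc n)) ¬all∈)
...   | a , a∈ , a∉ = a , ≤-pred (∈-upTo⁻ a∈) , a∉

module _ {A : Set} where

  complement : {xs ys : List A} → xs ⊆ ys → List A
  complement [] = []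
  complement (y ∷ʳ p) = y ∷ complement p
  complement (_ ∷ p) = complement p

  length-complement : {xs ys : List A} (p : xs ⊆ ys) → length xs + length (complement p) ≡ length ys
  length-complement [] = refl
  length-complement {xs} (y ∷ʳ p) = trans (+-suc (length xs) _) (cong suc (length-complement p))
  length-complement (_ ∷ p) = cong suc (length-complement p)

  ∃-sublist? : (P : List A → Set) → (∀ xs → Dec (P xs)) → (ys : List A) → Dec (∃[ xs ] (xs ⊆ ys × P xs))
  ∃-sublist? P P? [] with P? []
  ... | yes p = yes ([] , [] , p)
  ... | no ¬p = no λ { (_ , [] , p) → ¬p p }
  ∃-sublist? P P? (y ∷ ys) with ∃-sublist? P P? ys | ∃-sublist? (P ∘ (y ∷_)) (P? ∘ (y ∷_)) ys
  ... | yes (xs , s , p) | _ = yes (xs , y ∷ʳ s , p)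
  ... | no _ | yes (xs , s , p) = yes (y ∷ xs , refl ∷ s , p)
  ... | no ¬skip | no ¬keep = no λ where
    (xs , _ ∷ʳ s , p) → ¬skip (xs , s , p)
    (_ ∷ xs , refl ∷ s , p) → ¬keep (xs , s , p)

-- Hall's marriage theorem

module Hall {A B : Set} (_≟_ : DecidableEquality B) (E : A → B → Bool) where

  adjacent : List A → B → Bool
  adjacent [] n = false
  adjacent (x ∷ xs) n = E x n ∨ adjacent xs n

  neighbours : List B → List A → ℕ
  neighbours U S = count (adjacent S) U

  HallCondition : List B → List A → Set
  HallCondition U R = ∀ {S} → S ⊆ R → length S ≤ neighbours U S

  Matching : List B → List A → List B → Set
  Matching U = Pointwise (λ x n → E x n ≡ true × n ∈ U)

  Matchable : List B → List A → Set
  Matchable U R = ∃[ ns ] (Matching U R ns × Unique ns)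

  adjacent-mono : {T S : List A} → T ⊆ S → ∀ n → adjacent T n ≡ true → adjacent S n ≡ true
  adjacent-mono (y ∷ʳ p) n h rewrite adjacent-mono p n h = ∨-zeroʳ (E y n)
  adjacent-mono (_∷_ {x = y} refl p) n h with E y n
  ... | true = refl
  ... | false = adjacent-mono p n h

  Matching-mono : {U U' : List B} {R : List A} {ns : List B} →
    (∀ {z} → z ∈ U → z ∈ U') → Matching U R ns → Matching U' R ns
  Matching-mono h [] = []
  Matching-mono h ((e , n∈) ∷ m) = (e , h n∈) ∷ Matching-mono h m

  Matching-∈ : {U : List B} {R : List A} {ns : List B} → Matching U R ns → ∀ {z} → z ∈ ns → z ∈ U
  Matching-∈ ((_ , n∈) ∷ m) (here refl) = n∈
  Matching-∈ (_ ∷ m) (there z∈) = Matching-∈ m z∈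

  merge : {S R T : List A} (p : S ⊆ R) → T ⊆ complement p →
    ∃[ X ] (X ⊆ R × length X ≡ length S + length T × (∀ n → adjacent X n ≡ adjacent S n ∨ adjacent T n))
  merge [] [] = [] , [] , refl , λ n → refl
  merge (_ ∷ʳ p) (_ ∷ʳ q) with X , X⊆ , ∣X∣ , adjX ← merge p q = X , _ ∷ʳ X⊆ , ∣X∣ , adjX
  merge {S} {T = y ∷ T} (_ ∷ʳ p) (refl ∷ q) with X , X⊆ , ∣X∣ , adjX ← merge p q =
    y ∷ X , refl ∷ X⊆ , trans (cong suc ∣X∣) (sym (+-suc (length S) (length T))) ,
    λ n → trans (cong (E y n ∨_) (adjX n)) (∨-exchange (E y n) (adjacent S n) (adjacent T n))
    where
    ∨-exchange : ∀ a b c → a ∨ (b ∨ c) ≡ b ∨ (a ∨ c)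
    ∨-exchange true b c rewrite ∨-zeroʳ b = refl
    ∨-exchange false b c = refl
  merge (_∷_ {x = y} refl p) q with X , X⊆ , ∣X∣ , adjX ← merge p q =
    y ∷ X , refl ∷ X⊆ , cong suc ∣X∣ , λ n → trans (cong (E y n ∨_) (adjX n)) (sym (∨-assoc (E y n) _ _))

  interleave : {U : List B} {S R : List A} {a b : List B} (p : S ⊆ R) →
    Matching U S a → Matching U (complement p) b → Unique a → Unique b → Disjoint a b →
    ∃[ ns ] (Matching U R ns × Unique ns × (∀ {z} → z ∈ ns → z ∈ a ⊎ z ∈ b))
  interleave [] [] [] a! b! a#b = [] , [] , [] , λ ()
  interleave (_ ∷ʳ p) ma (e ∷ mb) a! (n≢b ∷ b!) a#b
    with ns , m , ns! , ns⊆ ← interleave p ma mb a! b! (λ (z∈a , z∈b) → a#b (z∈a , there z∈b)) =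
    _ ∷ ns , e ∷ m , ¬Any⇒All¬ ns (λ n∈ns → [ (λ n∈a → a#b (n∈a , here refl)) , All¬⇒¬Any n≢b ]′ (ns⊆ n∈ns)) ∷ ns! ,
    λ { (here refl) → inj₂ (here refl) ; (there z∈) → Sum.map₂ there (ns⊆ z∈) }
  interleave (refl ∷ p) (e ∷ ma) mb (n≢a ∷ a!) b! a#b
    with ns , m , ns! , ns⊆ ← interleave p ma mb a! b! (λ (z∈a , z∈b) → a#b (there z∈a , z∈b)) =
    _ ∷ ns , e ∷ m , ¬Any⇒All¬ ns (λ n∈ns → [ All¬⇒¬Any n≢a , (λ n∈b → a#b (here refl , n∈b)) ]′ (ns⊆ n∈ns)) ∷ ns! ,
    λ { (here refl) → inj₁ (here refl) ; (there z∈) → Sum.map₁ there (ns⊆ z∈) }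


  -- The classical split at a critical set S, i.e. one with |N(S) ∩ U| = |S|.
  HallCondition-inside : {U : List B} {R S : List A} → S ⊆ R → HallCondition U R →
    HallCondition (filterᵇ (adjacent S) U) S
  HallCondition-inside {U} {R} {S} S⊆R hc {T} T⊆S = begin
    length T                                        ≤⟨ hc (⊆-trans T⊆S S⊆R) ⟩
    count (adjacent T) U                            ≡⟨ sumWhere-cong _ _ _ U (λ n _ → adjacent-∧ n) ⟩
    count (λ n → adjacent S n ∧ adjacent T n) U     ≡⟨ sym (sumWhere-filterᵇ _ (adjacent S) (adjacent T) U) ⟩
    neighbours (filterᵇ (adjacent S) U) T           ∎
    where
    open ≤-Reasoning
    adjacent-∧ : ∀ n → adjacent T n ≡ adjacent S n ∧ adjacent T n
    adjacent-∧ n with adjacent T n in adjT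
    ... | true = sym (cong (_∧ true) (adjacent-mono T⊆S n adjT))
    ... | false = sym (∧-zeroʳ (adjacent S n))

  HallCondition-outside : {U : List B} {R S : List A} (p : S ⊆ R) → HallCondition U R →
    length S ≡ neighbours U S → HallCondition (filterᵇ (not ∘ adjacent S) U) (complement p)
  HallCondition-outside {U} {R} {S} p hc critical {T} q with X , X⊆R , ∣X∣ , adjX ← merge p q =
    +-cancelˡ-≤ (length S) _ _ (begin
      length S + length T                                             ≡⟨ sym ∣X∣ ⟩
      length X                                                        ≤⟨ hc X⊆R ⟩
      count (adjacent X) U                                            ≡⟨ sumWhere-cong _ _ _ U (λ n _ → adjX n) ⟩
      count (λ n → adjacent S n ∨ adjacent T n) U                     ≡⟨ sumWhere-∨ _ (adjacent S) (adjacent T) U ⟩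
      neighbours U S + count (λ n → not (adjacent S n) ∧ adjacent T n) U
        ≡⟨ cong₂ _+_ (sym critical) (sym (sumWhere-filterᵇ _ (not ∘ adjacent S) (adjacent T) U)) ⟩
      length S + neighbours (filterᵇ (not ∘ adjacent S) U) T          ∎)
    where open ≤-Reasoning

  Critical : List B → List A → List A → Set
  Critical U R S = 1 ≤ length S × length S < length R × neighbours U S ≤ length S

  critical? : (U : List B) (R S : List A) → Dec (Critical U R S)
  critical? U R S = (1 ≤? length S) ×-dec (length S <? length R) ×-dec (neighbours U S ≤? length S)

  HallUpTo : ℕ → Set
  HallUpTo k = ∀ R → length R ≤ k → ∀ U → Unique U → HallCondition U R → Matchable U R

  matchable-split : {k : ℕ} {U : List B} {R S : List A} → HallUpTo k → length R ≤ suc k →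
    Unique U → HallCondition U R → (p : S ⊆ R) → Critical U R S → Matchable U R
  matchable-split {k} {U} {R} {S} match ∣R∣≤ U! hc p (1≤∣S∣ , ∣S∣<∣R∣ , N≤∣S∣) =
    let a , ma , a! = match S (≤-pred (≤-trans ∣S∣<∣R∣ ∣R∣≤)) U₁ (Unique.filter⁺ _ U!) (HallCondition-inside {U} p hc)
        b , mb , b! = match (complement p) ∣S̅∣≤k U₂ (Unique.filter⁺ _ U!)
                        (HallCondition-outside {U} p hc (≤-antisym (hc p) N≤∣S∣))
        ns , m , ns! , _ = interleave p (Matching-mono (∈-filterᵇ⁻' _) ma) (Matching-mono (∈-filterᵇ⁻' _) mb)
                             a! b! (disjoint ma mb)
    in ns , m , ns!
    where
    U₁ = filterᵇ (adjacent S) U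
    U₂ = filterᵇ (not ∘ adjacent S) U
    ∈-filterᵇ⁻' : (P : B → Bool) {z : B} → z ∈ filterᵇ P U → z ∈ U
    ∈-filterᵇ⁻' P = proj₁ ∘ ∈-filterᵇ⁻ P U
    ∣S̅∣≤k : length (complement p) ≤ k
    ∣S̅∣≤k = +-cancelˡ-≤ 1 _ _ (≤-trans (+-monoˡ-≤ _ 1≤∣S∣) (≤-trans (≤-reflexive (length-complement p)) ∣R∣≤))
    disjoint : {T T' : List A} {a b : List B} → Matching U₁ T a → Matching U₂ T' b → Disjoint a b
    disjoint ma mb (z∈a , z∈b) with proj₂ (∈-filterᵇ⁻ _ U (Matching-∈ ma z∈a)) | proj₂ (∈-filterᵇ⁻ _ U (Matching-∈ mb z∈b))
    ... | adj | ¬adj rewrite adj with () ← ¬adj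

  -- Without critical sets, any neighbour n of x can be used for x: removing n from U keeps
  -- Hall's condition for the remaining vertices.
  matchable-greedy : {k : ℕ} {U : List B} {x : A} {R : List A} → HallUpTo k → length R ≤ k →
    Unique U → HallCondition U (x ∷ R) → (∀ {S} → S ⊆ x ∷ R → ¬ Critical U (x ∷ R) S) →
    Matchable U (x ∷ R)
  matchable-greedy {U = U} {x} {R} match ∣R∣≤k U! hc no-critical
    with n , n∈U , adj , _ ← sumWhere-positive _ (adjacent (x ∷ [])) U (hc (refl ∷ minimum R))
    = let ns , m , ns! = match R ∣R∣≤k (without _≟_ n U) (Unique.filter⁺ _ U!) hc' in
      n ∷ ns , (trans (sym (∨-identityʳ (E x n))) adj , n∈U) ∷ Matching-mono (∈-without⁻ _≟_ n U) m ,
      ¬Any⇒All¬ ns (∉-without _≟_ n U ∘ Matching-∈ m) ∷ ns!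
    where
    hc' : HallCondition (without _≟_ n U) R
    hc' {[]} _ = z≤n
    hc' {t ∷ T} T⊆R = ≤-pred (≤-trans (≰⇒> ¬critical) (count-without _≟_ (adjacent (t ∷ T)) n U!))
      where
      ¬critical : ¬ neighbours U (t ∷ T) ≤ length (t ∷ T)
      ¬critical N≤ = no-critical (x ∷ʳ T⊆R) (s≤s z≤n , s≤s (length-mono-≤ T⊆R) , N≤)

  hall : ∀ k → HallUpTo k
  hall _ [] _ U _ _ = [] , [] , []
  hall (suc k) (x ∷ R) (s≤s ∣R∣≤k) U U! hc with ∃-sublist? (Critical U (x ∷ R)) (critical? U (x ∷ R)) (x ∷ R)
  ... | yes (S , p , critical) = matchable-split (hall k) (s≤s ∣R∣≤k) U! hc p critical
  ... | no ¬critical = matchable-greedy (hall k) ∣R∣≤k U! hc (λ p critical → ¬critical (_ , p , critical))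

  hall-theorem : {U : List B} {R : List A} → Unique U → HallCondition U R → Matchable U R
  hall-theorem {U} {R} = hall (length R) R ≤-refl U


  matchingAt : {U : List B} {R : List A} {ns : List B} → Matching U R ns → Fin (length R) → B
  matchingAt (_∷_ {y = n} _ _) Fin.zero = n
  matchingAt (_ ∷ m) (Fin.suc i) = matchingAt m i

  matchingAt-∈ : {U : List B} {R : List A} {ns : List B} (m : Matching U R ns) (i : Fin (length R)) →
    matchingAt m i ∈ ns
  matchingAt-∈ (_ ∷ m) Fin.zero = here refl
  matchingAt-∈ (_ ∷ m) (Fin.suc i) = there (matchingAt-∈ m i)

  matchingAt-edge : {U : List B} {R : List A} {ns : List B} (m : Matching U R ns) (i : Fin (length R)) →
    E (lookup R i) (matchingAt m i) ≡ true
  matchingAt-edge ((e , _) ∷ m) Fin.zero = e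
  matchingAt-edge (_ ∷ m) (Fin.suc i) = matchingAt-edge m i

  matchingAt-injective : {U : List B} {R : List A} {ns : List B} (m : Matching U R ns) → Unique ns →
    Injective _≡_ _≡_ (matchingAt m)
  matchingAt-injective (_ ∷ m) _ {Fin.zero} {Fin.zero} _ = refl
  matchingAt-injective (_ ∷ m) (n≢ns ∷ _) {Fin.zero} {Fin.suc j} eq = ⊥-elim (All¬⇒¬Any n≢ns (subst (_∈ _) (sym eq) (matchingAt-∈ m j)))
  matchingAt-injective (_ ∷ m) (n≢ns ∷ _) {Fin.suc i} {Fin.zero} eq = ⊥-elim (All¬⇒¬Any n≢ns (subst (_∈ _) eq (matchingAt-∈ m i)))
  matchingAt-injective (_ ∷ m) (_ ∷ ns!) {Fin.suc i} {Fin.suc j} eq = cong Fin.suc (matchingAt-injective m ns! eq)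

-- Stated with cross-added sides so that no subtraction of naturals occurs.
[+a]-[+b]≤[+c]-[+d] : (a b c d : ℕ) → a + d ≤ c + b → ℤ.+ a ℤ.- ℤ.+ b ℤ.≤ ℤ.+ c ℤ.- ℤ.+ d
[+a]-[+b]≤[+c]-[+d] a b c d h
  rewrite ℤ.[+m]-[+n]≡m⊖n a b | ℤ.[+m]-[+n]≡m⊖n c d
        | sym (ℤ.+-cancelˡ-⊖ d a b) | sym (ℤ.+-cancelˡ-⊖ b c d) | +-comm b d
  = ℤ.⊖-monoˡ-≤ (d + b) (subst₂ _≤_ (+-comm a d) (+-comm c b) h)

[+a]-[+b]<[+c]-[+d] : (a b c d : ℕ) → a + d < c + b → ℤ.+ a ℤ.- ℤ.+ b ℤ.< ℤ.+ c ℤ.- ℤ.+ d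
[+a]-[+b]<[+c]-[+d] a b c d h
  rewrite ℤ.[+m]-[+n]≡m⊖n a b | ℤ.[+m]-[+n]≡m⊖n c d
        | sym (ℤ.+-cancelˡ-⊖ d a b) | sym (ℤ.+-cancelˡ-⊖ b c d) | +-comm b d
  = ℤ.⊖-monoˡ-< (d + b) (subst₂ _<_ (+-comm a d) (+-comm c b) h)

injection-length : {B : Set} {k : ℕ} (U : List B) (m : Fin k → B) → Injective _≡_ _≡_ m → (∀ i → m i ∈ U) → k ≤ length U
injection-length U m m-inj m∈U = injective⇒≤ {f = Any.index ∘ m∈U} λ {i} {j} eq → m-inj (begin
  m i                        ≡⟨ lookup-index (m∈U i) ⟩
  lookup U (Any.index (m∈U i)) ≡⟨ cong (lookup U) eq ⟩
  lookup U (Any.index (m∈U j)) ≡⟨ sym (lookup-index (m∈U j)) ⟩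
  m j                        ∎)
  where open ≡-Reasoning

≡ᵇ-refl : (n : ℕ) → (n ≡ᵇ n) ≡ true
≡ᵇ-refl zero = refl
≡ᵇ-refl (suc n) = ≡ᵇ-refl n

module _ {A : Set} (P : A → Bool) where

  any⇒∃ : (xs : List A) → any P xs ≡ true → ∃[ x ] (x ∈ xs × P x ≡ true)
  any⇒∃ (x ∷ xs) h with P x in eq
  ... | true = x , here refl , eq
  ... | false = map₂ (map₁ there) (any⇒∃ xs h)

  ∃⇒any : {x : A} (xs : List A) → x ∈ xs → P x ≡ true → any P xs ≡ true
  ∃⇒any (x ∷ xs) (here refl) Px rewrite Px = refl
  ∃⇒any (y ∷ xs) (there x∈xs) Px rewrite ∃⇒any xs x∈xs Px = ∨-zeroʳ (P y)

module Leanness (D : ℕ → ℕ) where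

  _≟C_ : DecidableEquality (Clause D)
  _≟C_ = _≟ᶜ_ D

  mult-here : (X : Clause D) (F : MCS D) → mult D (X ∷ F) X ≡ suc (mult D F X)
  mult-here X F with X ≟C X
  ... | yes _ = refl
  ... | no X≢X = ⊥-elim (X≢X refl)

  mult-there : (X : Clause D) (F : MCS D) {C : Clause D} → C ≢ X → mult D (X ∷ F) C ≡ mult D F C
  mult-there X F {C} C≢X with C ≟C X
  ... | yes C≡X = ⊥-elim (C≢X C≡X)
  ... | no _ = refl

  mult-positive⇒∈ : (F : MCS D) {C : Clause D} → 1 ≤ mult D F C → C ∈ F
  mult-positive⇒∈ (X ∷ F) {C} h with C ≟C X
  ... | yes refl = here refl
  ... | no _ = there (mult-positive⇒∈ F h)

  ∈⇒mult-positive : (F : MCS D) {C : Clause D} → C ∈ F → 1 ≤ mult D F C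
  ∈⇒mult-positive (X ∷ F) (here refl) rewrite mult-here X F = s≤s z≤n
  ∈⇒mult-positive (X ∷ F) {C} (there p) with C ≟C X
  ... | yes _ = s≤s z≤n
  ... | no _ = ∈⇒mult-positive F p

  mult-++ : (F G : MCS D) (C : Clause D) → mult D (F ++ G) C ≡ mult D F C + mult D G C
  mult-++ [] G C = refl
  mult-++ (X ∷ F) G C with C ≟C X
  ... | yes _ = cong suc (mult-++ F G C)
  ... | no _ = mult-++ F G C

  mult-remove1-self : (F : MCS D) (C : Clause D) → mult D (remove1 D C F) C ≡ mult D F C ∸ 1
  mult-remove1-self [] C = refl
  mult-remove1-self (X ∷ F) C with C ≟C X
  ... | yes refl = refl
  ... | no C≢X = trans (mult-there X _ C≢X) (mult-remove1-self F C)

  mult-remove1-other : (F : MCS D) {C C' : Clause D} → C' ≢ C → mult D (remove1 D C F) C' ≡ mult D F C'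
  mult-remove1-other [] C'≢C = refl
  mult-remove1-other (X ∷ F) {C} {C'} C'≢C with C ≟C X
  ... | yes refl = sym (mult-there C F C'≢C)
  ... | no _ with C' ≟C X
  ...   | yes _ = cong suc (mult-remove1-other F C'≢C)
  ...   | no _ = mult-remove1-other F C'≢C

  length-remove1 : (F : MCS D) {C : Clause D} → C ∈ F → length F ≡ suc (length (remove1 D C F))
  length-remove1 (X ∷ F) {C} p with C ≟C X
  ... | yes _ = refl
  length-remove1 (X ∷ F) (here refl) | no C≢C = ⊥-elim (C≢C refl)
  length-remove1 (X ∷ F) (there p) | no _ = cong suc (length-remove1 F p)

  ≤ₘ-refl : {F : MCS D} → _≤ₘ_ D F F
  ≤ₘ-refl C = ≤-refl

  ≤ₘ-trans : {F G H : MCS D} → _≤ₘ_ D F G → _≤ₘ_ D G H → _≤ₘ_ D F H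
  ≤ₘ-trans F≤G G≤H C = ≤-trans (F≤G C) (G≤H C)

  ≈ₘ⇒≤ₘ : {F G : MCS D} → _≈ₘ_ D F G → _≤ₘ_ D F G
  ≈ₘ⇒≤ₘ F≈G C = ≤-reflexive (F≈G C)

  ≈ₘ-sym : {F G : MCS D} → _≈ₘ_ D F G → _≈ₘ_ D G F
  ≈ₘ-sym F≈G C = sym (F≈G C)

  mult-∈-remove1 : (F : MCS D) {C : Clause D} → C ∈ F → mult D F C ≡ suc (mult D (remove1 D C F) C)
  mult-∈-remove1 F {C} C∈F with mult D F C in eq | ∈⇒mult-positive F C∈F
  ... | suc k | _ = cong suc (sym (trans (mult-remove1-self F C) (cong (_∸ 1) eq)))

  remove1-≤ₘ : (F : MCS D) (C : Clause D) → _≤ₘ_ D (remove1 D C F) F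
  remove1-≤ₘ F C C' with C' ≟C C
  ... | yes refl = subst (_≤ mult D F C) (sym (mult-remove1-self F C)) (m∸n≤m _ 1)
  ... | no C'≢C = ≤-reflexive (mult-remove1-other F C'≢C)

  ≤ₘ-remove1 : (F G : MCS D) (C : Clause D) → _≤ₘ_ D G F → mult D G C < mult D F C →
    _≤ₘ_ D G (remove1 D C F)
  ≤ₘ-remove1 F G C G≤F G<F C' with C' ≟C C
  ... | yes refl = ≤-pred (subst (mult D G C <_) (mult-∈-remove1 F (mult-positive⇒∈ F (≤-trans (s≤s z≤n) G<F))) G<F)
  ... | no C'≢C = subst (mult D G C' ≤_) (sym (mult-remove1-other F C'≢C)) (G≤F C')

  ⊆⇒≤ₘ : {G F : MCS D} → G ⊆ F → _≤ₘ_ D G F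
  ⊆⇒≤ₘ [] C = z≤n
  ⊆⇒≤ₘ (X ∷ʳ p) C with C ≟C X
  ... | yes _ = m≤n⇒m≤1+n (⊆⇒≤ₘ p C)
  ... | no _ = ⊆⇒≤ₘ p C
  ⊆⇒≤ₘ (_∷_ {x = X} refl p) C with C ≟C X
  ... | yes _ = s≤s (⊆⇒≤ₘ p C)
  ... | no _ = ⊆⇒≤ₘ p C

  ≤ₘ⇒⊆ : (F F' : MCS D) → _≤ₘ_ D F' F →
    ∃[ G ] (G ⊆ F × _≈ₘ_ D G F' × length G ≡ length F')
  ≤ₘ⇒⊆ [] [] _ = [] , [] , (λ C → refl) , refl
  ≤ₘ⇒⊆ [] (X ∷ F') F'≤[] with () ← subst (_≤ 0) (mult-here X F') (F'≤[] X)
  ≤ₘ⇒⊆ (X ∷ F) F' F'≤F with mult D F' X in eq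
  ... | zero = let G , G⊆F , G≈F' , ∣G∣ = ≤ₘ⇒⊆ F F' F'≤F₀ in G , X ∷ʳ G⊆F , G≈F' , ∣G∣
    where
    F'≤F₀ : _≤ₘ_ D F' F
    F'≤F₀ C with C ≟C X
    ... | yes refl = subst (_≤ mult D F C) (sym eq) z≤n
    ... | no C≢X = subst (mult D F' C ≤_) (mult-there X F C≢X) (F'≤F C)
  ... | suc _ = let G , G⊆F , G≈F'₀ , ∣G∣ = ≤ₘ⇒⊆ F (remove1 D X F') F'₀≤F in
    X ∷ G , refl ∷ G⊆F , X∷G≈F' G≈F'₀ , trans (cong suc ∣G∣) (sym (length-remove1 F' X∈F'))
    where
    X∈F' : X ∈ F'
    X∈F' = mult-positive⇒∈ F' (subst (1 ≤_) (sym eq) (s≤s z≤n))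
    F'₀≤F : _≤ₘ_ D (remove1 D X F') F
    F'₀≤F C with C ≟C X
    ... | yes refl = ≤-pred (subst₂ _≤_ (mult-∈-remove1 F' X∈F') (mult-here C F) (F'≤F C))
    ... | no C≢X = subst₂ _≤_ (sym (mult-remove1-other F' C≢X)) (mult-there X F C≢X) (F'≤F C)
    X∷G≈F' : {G : MCS D} → _≈ₘ_ D G (remove1 D X F') → _≈ₘ_ D (X ∷ G) F'
    X∷G≈F' {G} G≈F'₀ C with C ≟C X
    ... | yes refl = trans (cong suc (G≈F'₀ C)) (sym (mult-∈-remove1 F' X∈F'))
    ... | no C≢X = trans (G≈F'₀ C) (mult-remove1-other F' C≢X)

  length-mono-≤ₘ : (F' F : MCS D) → _≤ₘ_ D F' F → length F' ≤ length F
  length-mono-≤ₘ F' F F'≤F with G , G⊆F , _ , ∣G∣ ← ≤ₘ⇒⊆ F F' F'≤F =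
    subst (_≤ length F) ∣G∣ (length-mono-≤ G⊆F)

  length-cong-≈ₘ : (F' F : MCS D) → _≈ₘ_ D F' F → length F' ≡ length F
  length-cong-≈ₘ F' F F'≈F =
    ≤-antisym (length-mono-≤ₘ F' F (≈ₘ⇒≤ₘ {F'} {F} F'≈F)) (length-mono-≤ₘ F F' (≈ₘ⇒≤ₘ {F} {F'} (≈ₘ-sym {F'} {F} F'≈F)))

  ∈-mono-≤ₘ : (F G : MCS D) → _≤ₘ_ D F G → {C : Clause D} → C ∈ F → C ∈ G
  ∈-mono-≤ₘ F G F≤G {C} C∈F = mult-positive⇒∈ G (≤-trans (∈⇒mult-positive F C∈F) (F≤G C))


  ∈-subs⁺ : {G F : MCS D} → G ⊆ F → G ∈ subs D F
  ∈-subs⁺ [] = here refl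
  ∈-subs⁺ {F = X ∷ F} (_ ∷ʳ p) = ∈-++⁺ˡ (∈-subs⁺ p)
  ∈-subs⁺ {F = X ∷ F} (refl ∷ p) = ∈-++⁺ʳ (subs D F) (∈-map⁺ (X ∷_) (∈-subs⁺ p))

  ∈-subs⁻ : {G : MCS D} (F : MCS D) → G ∈ subs D F → G ⊆ F
  ∈-subs⁻ [] (here refl) = []
  ∈-subs⁻ (X ∷ F) G∈ with ∈-++⁻ (subs D F) G∈
  ... | inj₁ G∈₁ = X ∷ʳ ∈-subs⁻ F G∈₁
  ... | inj₂ G∈₂ with G , G∈' , refl ← ∈-map⁻ (X ∷_) G∈₂ = refl ∷ ∈-subs⁻ F G∈'

  proper⇒mult-< : (F F' : MCS D) → _≤ₘ_ D F' F → ¬ _≈ₘ_ D F' F →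
    ∃[ C ] (C ∈ F × mult D F' C < mult D F C)
  proper⇒mult-< F F' F'≤F F'≉F with Any.any? (λ C → mult D F' C <? mult D F C) F
  ... | yes some = find some
  ... | no none = ⊥-elim (F'≉F F'≈F)
    where
    F'≈F : _≈ₘ_ D F' F
    F'≈F C with mult D F C in eq
    ... | zero = n≤0⇒n≡0 (subst (mult D F' C ≤_) eq (F'≤F C))
    ... | suc _ = ≤-antisym (subst (mult D F' C ≤_) eq (F'≤F C))
                   (≮⇒≥ (λ F'<F → none (lose (mult-positive⇒∈ F (subst (1 ≤_) (sym eq) (s≤s z≤n)))
                                              (subst (mult D F' C <_) (sym eq) F'<F))))

  _∖ₘ_ : MCS D → MCS D → MCS D
  F ∖ₘ G = foldr (remove1 D) F G

  mult-∖ₘ : (F G : MCS D) (C : Clause D) → mult D (F ∖ₘ G) C ≡ mult D F C ∸ mult D G C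
  mult-∖ₘ F [] C = refl
  mult-∖ₘ F (X ∷ G) C with C ≟C X
  ... | yes refl = begin
      mult D (remove1 D C (F ∖ₘ G)) C   ≡⟨ mult-remove1-self (F ∖ₘ G) C ⟩
      mult D (F ∖ₘ G) C ∸ 1             ≡⟨ cong (_∸ 1) (mult-∖ₘ F G C) ⟩
      mult D F C ∸ mult D G C ∸ 1       ≡⟨ ∸-+-assoc (mult D F C) (mult D G C) 1 ⟩
      mult D F C ∸ (mult D G C + 1)     ≡⟨ cong (mult D F C ∸_) (+-comm (mult D G C) 1) ⟩
      mult D F C ∸ suc (mult D G C)     ∎
    where open ≡-Reasoning
  ... | no C≢X = trans (mult-remove1-other (F ∖ₘ G) C≢X) (mult-∖ₘ F G C)

  memᵇ⇒∈ : (v : ℕ) (vs : List ℕ) → memᵇ D v vs ≡ true → v ∈ vs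
  memᵇ⇒∈ v (w ∷ ws) h with v ≡ᵇ w in eq
  ... | true = here (≡ᵇ⇒≡ v w (Equivalence.from T-≡ eq))
  ... | false = there (memᵇ⇒∈ v ws h)

  ∈⇒memᵇ : (v : ℕ) (vs : List ℕ) → v ∈ vs → memᵇ D v vs ≡ true
  ∈⇒memᵇ v (w ∷ ws) (here refl) rewrite ≡ᵇ-refl v = refl
  ∈⇒memᵇ v (w ∷ ws) (there p) rewrite ∈⇒memᵇ v ws p = ∨-zeroʳ (v ≡ᵇ w)

  occurs : MCS D → ℕ → Bool
  occurs [] v = false
  occurs (C ∷ F) v = memᵇ D v (varFM D C) ∨ occurs F v

  occurs⇒∈ : (F : MCS D) (v : ℕ) → occurs F v ≡ true → ∃[ C ] (C ∈ F × v ∈ varFM D C)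
  occurs⇒∈ (C ∷ F) v h with memᵇ D v (varFM D C) in eq
  ... | true = C , here refl , memᵇ⇒∈ v (varFM D C) eq
  ... | false = map₂ (map₁ there) (occurs⇒∈ F v h)

  ∈⇒occurs : (F : MCS D) (v : ℕ) {C : Clause D} → C ∈ F → v ∈ varFM D C → occurs F v ≡ true
  ∈⇒occurs (C ∷ F) v (here refl) v∈C rewrite ∈⇒memᵇ v (varFM D C) v∈C = refl
  ∈⇒occurs (C' ∷ F) v (there C∈F) v∈C rewrite ∈⇒occurs F v C∈F v∈C = ∨-zeroʳ _

  ∈-var⁻ : (F : MCS D) (v : ℕ) → v ∈ var D F → occurs F v ≡ true
  ∈-var⁻ F v v∈F with _ , C∈F , v∈C ← find (∈-concatMap⁻ (varFM D) {xs = F} (∈-deduplicate⁻ Data.Nat._≟_ _ v∈F)) =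
    ∈⇒occurs F v C∈F v∈C

  ∈-var⁺ : (F : MCS D) (v : ℕ) → occurs F v ≡ true → v ∈ var D F
  ∈-var⁺ F v h with C , C∈F , v∈C ← occurs⇒∈ F v h =
    ∈-deduplicate⁺ Data.Nat._≟_ (∈-concatMap⁺ (varFM D) (lose C∈F v∈C))

  occurs-mono : (F G : MCS D) (v : ℕ) → _≤ₘ_ D F G → occurs F v ≡ true → occurs G v ≡ true
  occurs-mono F G v F≤G h with C , C∈F , v∈C ← occurs⇒∈ F v h = ∈⇒occurs G v (∈-mono-≤ₘ F G F≤G C∈F) v∈C

  occurs-cong : (F G : MCS D) (v : ℕ) → _≈ₘ_ D F G → occurs F v ≡ occurs G v
  occurs-cong F G v F≈G with occurs F v in eqF | occurs G v in eqG
  ... | true | true = refl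
  ... | false | false = refl
  ... | true | false = trans (sym (occurs-mono F G v (≈ₘ⇒≤ₘ {F} {G} F≈G) eqF)) eqG
  ... | false | true = trans (sym eqF) (occurs-mono G F v (≈ₘ⇒≤ₘ {G} {F} (≈ₘ-sym {F} {G} F≈G)) eqG)

  occurs-++ : (F G : MCS D) (v : ℕ) → occurs (F ++ G) v ≡ occurs F v ∨ occurs G v
  occurs-++ [] G v = refl
  occurs-++ (C ∷ F) G v rewrite occurs-++ F G v = sym (∨-assoc (memᵇ D v (varFM D C)) _ _)

  -- rd of every F' ≤ₘ F is computed as a sum over the common range upTo (bound F).
  bound : MCS D → ℕ
  bound F = suc (sum (var D F))

  occurs⇒<bound : (F F' : MCS D) → _≤ₘ_ D F' F → (v : ℕ) → occurs F' v ≡ true → v < bound F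
  occurs⇒<bound F F' F'≤F v h = s≤s (∈⇒≤sum (∈-var⁺ F v (occurs-mono F' F v F'≤F h)))
    where
    ∈⇒≤sum : {v : ℕ} {vs : List ℕ} → v ∈ vs → v ≤ sum vs
    ∈⇒≤sum {vs = w ∷ ws} (here refl) = m≤m+n w (sum ws)
    ∈⇒≤sum {vs = w ∷ ws} (there p) = ≤-trans (∈⇒≤sum p) (m≤n+m (sum ws) w)

  rd≡sumWhere : (F : MCS D) (N : ℕ) → (∀ v → occurs F v ≡ true → v < N) →
    rd D F ≡ sumWhere D (occurs F) (upTo N)
  rd≡sumWhere F N below = trans
    (≤-antisym (Unique-sum-mono D (deduplicate-! _) var⊆) (Unique-sum-mono D (Unique.filter⁺ _ (Unique.upTo⁺ N)) ⊆var))
    (sum-map-filterᵇ D (occurs F) (upTo N))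
    where
    var⊆ : ∀ {v} → v ∈ var D F → v ∈ filterᵇ (occurs F) (upTo N)
    var⊆ {v} v∈ = ∈-filterᵇ⁺ (occurs F) (upTo N) (∈-upTo⁺ (below v (∈-var⁻ F v v∈))) (∈-var⁻ F v v∈)
    ⊆var : ∀ {v} → v ∈ filterᵇ (occurs F) (upTo N) → v ∈ var D F
    ⊆var {v} v∈ = ∈-var⁺ F v (proj₂ (∈-filterᵇ⁻ (occurs F) (upTo N) v∈))

  rd-cong : (F G : MCS D) → _≈ₘ_ D F G → rd D F ≡ rd D G
  rd-cong F G F≈G = begin
    rd D F                                      ≡⟨ rd≡sumWhere F (bound G) (λ v h → below v (trans (sym (occurs-cong F G v F≈G)) h)) ⟩
    sumWhere D (occurs F) (upTo (bound G))      ≡⟨ sumWhere-cong D _ _ (upTo (bound G)) (λ v _ → occurs-cong F G v F≈G) ⟩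
    sumWhere D (occurs G) (upTo (bound G))      ≡⟨ sym (rd≡sumWhere G (bound G) below) ⟩
    rd D G                                      ∎
    where
    open ≡-Reasoning
    below = occurs⇒<bound G G (≤ₘ-refl {G})

  δ-cong : (F G : MCS D) → _≈ₘ_ D F G → δ D F ≡ δ D G
  δ-cong F G F≈G = cong₂ (λ a b → ℤ.+ a ℤ.- ℤ.+ b) (length-cong-≈ₘ F G F≈G) (rd-cong F G F≈G)

  δ*-upper : (F F' : MCS D) → _≤ₘ_ D F' F → δ D F' ℤ.≤ δ* D F
  δ*-upper F F' F'≤F with G , G⊆F , G≈F' , _ ← ≤ₘ⇒⊆ F F' F'≤F =
    subst (ℤ._≤ δ* D F) (δ-cong G F' G≈F')
      (All.lookup (foldr-forcesᵇ {P = ℤ._≤ δ* D F} ⊔-bounded (ℤ.+ 0) (map (δ D) (subs D F)) ℤ.≤-refl)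
                  (∈-map⁺ (δ D) (∈-subs⁺ G⊆F)))
    where
    ⊔-bounded : ∀ i j → i ⊔ j ℤ.≤ δ* D F → i ℤ.≤ δ* D F × j ℤ.≤ δ* D F
    ⊔-bounded i j h = ℤ.i⊔j≤k⇒i≤k i j h , ℤ.i⊔j≤k⇒j≤k i j h

  δ*-attained : (F : MCS D) → ∃[ G ] (_≤ₘ_ D G F × δ D G ≡ δ* D F)
  δ*-attained F with foldr-selective ℤ.⊔-sel (ℤ.+ 0) (map (δ D) (subs D F))
  ... | inj₁ δ*≡0 = [] , (λ C → z≤n) , sym δ*≡0
  ... | inj₂ δ*∈ with G , G∈ , eq ← ∈-map⁻ (δ D) δ*∈ = G , ⊆⇒≤ₘ (∈-subs⁻ F G∈) , sym eq

  -- Conditions (2), (3) and (4)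

  RemovalLowersδ* : MCS D → Set
  RemovalLowersδ* F = ∀ C → C ∈ F → δ* D (remove1 D C F) ℤ.< δ* D F

  ProperSubsLowerδ : MCS D → Set
  ProperSubsLowerδ F = ∀ F' → _≤ₘ_ D F' F → ¬ _≈ₘ_ D F' F → δ D F' ℤ.< δ D F

  UniquelyTight : MCS D → Set
  UniquelyTight F = Tight D F F × (∀ F' → Tight D F F' → _≈ₘ_ D F' F)

  ≈ₘ-by-δ : (F F' : MCS D) → ProperSubsLowerδ F → _≤ₘ_ D F' F → δ D F' ≡ δ D F → _≈ₘ_ D F' F
  ≈ₘ-by-δ F F' lower F'≤F δ≡ C with mult D F' C ≟ mult D F C
  ... | yes eq = eq
  ... | no neq = ⊥-elim (ℤ.<-irrefl δ≡ (lower F' F'≤F (λ F'≈F → neq (F'≈F C))))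

  δ-maximal : (F : MCS D) → ProperSubsLowerδ F → (F' : MCS D) → _≤ₘ_ D F' F → δ D F' ℤ.≤ δ D F
  δ-maximal F lower F' F'≤F = ℤ.≮⇒≥ λ δF<δF' →
    ℤ.<-asym δF<δF' (lower F' F'≤F (λ F'≈F → ℤ.<-irrefl (sym (δ-cong F' F F'≈F)) δF<δF'))

  ProperSubsLowerδ⇒δ≡δ* : (F : MCS D) → ProperSubsLowerδ F → δ D F ≡ δ* D F
  ProperSubsLowerδ⇒δ≡δ* F lower with G , G≤F , δG≡δ* ← δ*-attained F =
    ℤ.≤-antisym (δ*-upper F F (≤ₘ-refl {F})) (subst (ℤ._≤ δ D F) δG≡δ* (δ-maximal F lower G G≤F))

  ProperSubsLowerδ⇒UniquelyTight : (F : MCS D) → ProperSubsLowerδ F → UniquelyTight F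
  ProperSubsLowerδ⇒UniquelyTight F lower =
    (≤ₘ-refl {F} , ProperSubsLowerδ⇒δ≡δ* F lower) ,
    λ F' (F'≤F , δF'≡δ*) → ≈ₘ-by-δ F F' lower F'≤F (trans δF'≡δ* (sym (ProperSubsLowerδ⇒δ≡δ* F lower)))

  UniquelyTight⇒ProperSubsLowerδ : (F : MCS D) → UniquelyTight F → ProperSubsLowerδ F
  UniquelyTight⇒ProperSubsLowerδ F ((_ , δF≡δ*) , unique) F' F'≤F F'≉F = ℤ.≤∧≢⇒<
    (subst (δ D F' ℤ.≤_) (sym δF≡δ*) (δ*-upper F F' F'≤F))
    (λ δF'≡δF → F'≉F (unique F' (F'≤F , trans δF'≡δF δF≡δ*)))

  remove1-proper : (F G : MCS D) {C : Clause D} → C ∈ F → _≤ₘ_ D G (remove1 D C F) → ¬ _≈ₘ_ D G F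
  remove1-proper F G {C} C∈F G≤F-C G≈F = 1+n≰n (begin
    suc (mult D F C)                  ≡⟨ cong suc (sym (G≈F C)) ⟩
    suc (mult D G C)                  ≤⟨ s≤s (G≤F-C C) ⟩
    suc (mult D (remove1 D C F) C)    ≡⟨ sym (mult-∈-remove1 F C∈F) ⟩
    mult D F C                        ∎)
    where open ≤-Reasoning

  ProperSubsLowerδ⇒RemovalLowersδ* : (F : MCS D) → ProperSubsLowerδ F → RemovalLowersδ* F
  ProperSubsLowerδ⇒RemovalLowersδ* F lower C C∈F with G , G≤F-C , δG≡δ* ← δ*-attained (remove1 D C F) =
    subst (ℤ._< δ* D F) δG≡δ*
      (ℤ.<-≤-trans (lower G (≤ₘ-trans {G} {remove1 D C F} {F} G≤F-C (remove1-≤ₘ F C)) (remove1-proper F G C∈F G≤F-C))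
                   (δ*-upper F F (≤ₘ-refl {F})))

  RemovalLowersδ*⇒δ≡δ* : (F : MCS D) → RemovalLowersδ* F → δ D F ≡ δ* D F
  RemovalLowersδ*⇒δ≡δ* F lowers with G , G≤F , δG≡δ* ← δ*-attained F =
    trans (δ-cong F G (≈ₘ-sym {G} {F} G≈F)) δG≡δ*
    where
    G≈F : _≈ₘ_ D G F
    G≈F C with mult D G C ≟ mult D F C
    ... | yes eq = eq
    ... | no neq = ⊥-elim (ℤ.<-irrefl refl (ℤ.≤-<-trans
            (subst (ℤ._≤ δ* D (remove1 D C F)) δG≡δ* (δ*-upper (remove1 D C F) G (≤ₘ-remove1 F G C G≤F G<F)))
            (lowers C (mult-positive⇒∈ F (≤-trans (s≤s z≤n) G<F)))))
      where
      G<F : mult D G C < mult D F C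
      G<F = ≤∧≢⇒< (G≤F C) neq

  RemovalLowersδ*⇒ProperSubsLowerδ : (F : MCS D) → RemovalLowersδ* F → ProperSubsLowerδ F
  RemovalLowersδ*⇒ProperSubsLowerδ F lowers F' F'≤F F'≉F with C , C∈F , F'<F ← proper⇒mult-< F F' F'≤F F'≉F =
    subst (δ D F' ℤ.<_) (sym (RemovalLowersδ*⇒δ≡δ* F lowers))
      (ℤ.≤-<-trans (δ*-upper (remove1 D C F) F' (≤ₘ-remove1 F F' C F'≤F F'<F)) (lowers C C∈F))

  -- A non-trivial matching autarky violates (3)

  filterᵇ-≤ₘ : (P : Clause D → Bool) (F : MCS D) → _≤ₘ_ D (filterᵇ P F) F
  filterᵇ-≤ₘ P [] C = z≤n
  filterᵇ-≤ₘ P (X ∷ F) C with P X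
  ... | true with C ≟C X
  ...   | yes _ = s≤s (filterᵇ-≤ₘ P F C)
  ...   | no _ = filterᵇ-≤ₘ P F C
  filterᵇ-≤ₘ P (X ∷ F) C | false with C ≟C X
  ...   | yes _ = m≤n⇒m≤1+n (filterᵇ-≤ₘ P F C)
  ...   | no _ = filterᵇ-≤ₘ P F C

  nodesOf : ℕ → List (ℕ × ℕ)
  nodesOf v = map (v ,_) (applyUpTo suc (D v))

  varNodes : List ℕ → List (ℕ × ℕ)
  varNodes = concatMap nodesOf

  length-nodesOf : (v : ℕ) → length (nodesOf v) ≡ D v
  length-nodesOf v = trans (length-map (v ,_) (applyUpTo suc (D v))) (length-applyUpTo suc (D v))

  ∈-nodesOf⁺ : {v j : ℕ} → 1 ≤ j → j ≤ D v → (v , j) ∈ nodesOf v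
  ∈-nodesOf⁺ {v} {suc i} _ i<Dv = ∈-map⁺ (v ,_) (∈-applyUpTo⁺ suc i<Dv)

  ∈-varNodes⁺ : {v j : ℕ} (vs : List ℕ) → v ∈ vs → 1 ≤ j → j ≤ D v → (v , j) ∈ varNodes vs
  ∈-varNodes⁺ vs v∈vs 1≤j j≤Dv = ∈-concatMap⁺ nodesOf (lose v∈vs (∈-nodesOf⁺ 1≤j j≤Dv))

  ∈-varNodes⁻ : {v j : ℕ} (vs : List ℕ) → (v , j) ∈ varNodes vs → v ∈ vs × 1 ≤ j × j ≤ D v
  ∈-varNodes⁻ vs n∈ with w , w∈vs , n∈w ← find (∈-concatMap⁻ nodesOf {xs = vs} n∈)
                      with i , j∈ , refl ← ∈-map⁻ (w ,_) n∈w
                      with i' , i'<Dw , refl ← ∈-applyUpTo⁻ suc j∈ = w∈vs , s≤s z≤n , i'<Dw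

  length-varNodes : (vs : List ℕ) → length (varNodes vs) ≡ sum (map D vs)
  length-varNodes [] = refl
  length-varNodes (v ∷ vs) = begin
    length (nodesOf v ++ varNodes vs)           ≡⟨ length-++ (nodesOf v) ⟩
    length (nodesOf v) + length (varNodes vs)   ≡⟨ cong₂ _+_ (length-nodesOf v) (length-varNodes vs) ⟩
    D v + sum (map D vs)                        ∎
    where open ≡-Reasoning

  count-nodesOf : (P : ℕ → Bool) (v : ℕ) → count (P ∘ proj₁) (nodesOf v) ≡ (if P v then D v else 0)
  count-nodesOf P v = trans (count-map (applyUpTo suc (D v))) (cong (λ n → if P v then n else 0) (length-applyUpTo suc (D v)))
    where
    count-map : (js : List ℕ) → count (P ∘ proj₁) (map (v ,_) js) ≡ (if P v then length js else 0)
    count-map [] with P v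
    ... | true = refl
    ... | false = refl
    count-map (j ∷ js) with P v in eq
    ... | true = cong suc (trans (count-map js) (cong (if_then length js else 0) eq))
    ... | false = trans (count-map js) (cong (if_then length js else 0) eq)

  count-varNodes : (P : ℕ → Bool) (vs : List ℕ) → count (P ∘ proj₁) (varNodes vs) ≡ sumWhere D P vs
  count-varNodes P [] = refl
  count-varNodes P (v ∷ vs) = begin
    count (P ∘ proj₁) (nodesOf v ++ varNodes vs)                    ≡⟨ sumWhere-++ _ (P ∘ proj₁) (nodesOf v) (varNodes vs) ⟩
    count (P ∘ proj₁) (nodesOf v) + count (P ∘ proj₁) (varNodes vs) ≡⟨ cong₂ _+_ (count-nodesOf P v) (count-varNodes P vs) ⟩
    (if P v then D v else 0) + sumWhere D P vs                      ≡⟨ sym (sumWhere-∷ D P v vs) ⟩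
    sumWhere D P (v ∷ vs)                                           ∎
    where open ≡-Reasoning

  Unique-varNodes : {vs : List ℕ} → Unique vs → Unique (varNodes vs)
  Unique-varNodes [] = []
  Unique-varNodes {v ∷ vs} (v≢vs ∷ vs!) = Unique.++⁺
    (Unique.map⁺ (cong proj₂) (Unique.applyUpTo⁺₁ suc (D v) (λ i<j _ → <⇒≢ (s≤s i<j))))
    (Unique-varNodes vs!)
    λ (n∈v , n∈vs) → let _ , _ , n≡ = ∈-map⁻ (v ,_) n∈v in
      All¬⇒¬Any v≢vs (proj₁ (∈-varNodes⁻ vs (subst (_∈ varNodes vs) n≡ n∈vs)))

  touching : List ℕ → Clause D → Bool
  touching W C = any (λ v → memᵇ D v W) (varFM D C)

  untouched : List ℕ → MCS D → MCS D
  untouched W = filterᵇ (not ∘ touching W)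

  weightIn : List ℕ → MCS D → ℕ
  weightIn W F = sumWhere D (λ v → memᵇ D v W ∧ occurs F v) (upTo (bound F))

  matchingSatisfying⇒length-≤ : (φ : PAss D) (F R : MCS D) → _≤ₘ_ D R F → MatchingSatisfying D φ R →
    length R ≤ weightIn (varFM D φ) F
  matchingSatisfying⇒length-≤ φ F R R≤F (m , m-inj , m-edge) = begin
    length R                          ≤⟨ injection-length (varNodes used) m m-inj m∈ ⟩
    length (varNodes used)            ≡⟨ length-varNodes used ⟩
    sum (map D used)                  ≡⟨ sum-map-filterᵇ D inφ (upTo (bound F)) ⟩
    weightIn (varFM D φ) F            ∎
    where
    open ≤-Reasoning
    inφ : ℕ → Bool
    inφ v = memᵇ D v (varFM D φ) ∧ occurs F v
    used = filterᵇ inφ (upTo (bound F))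
    m∈ : ∀ i → m i ∈ varNodes used
    m∈ i with m i | m-edge i
    ... | v , j | 1≤j , j≤Dv , _ , _ , v∈φ , v∈C , _ = ∈-varNodes⁺ used
          (∈-filterᵇ⁺ inφ (upTo (bound F)) (∈-upTo⁺ (occurs⇒<bound F F (≤ₘ-refl {F}) v occursF)) used-v) 1≤j j≤Dv
      where
      occursF : occurs F v ≡ true
      occursF = ∈⇒occurs F v (∈-mono-≤ₘ R F R≤F (∈-lookup i)) (∈-map⁺ proj₁ v∈C)
      used-v : inφ v ≡ true
      used-v rewrite ∈⇒memᵇ v (varFM D φ) (∈-map⁺ proj₁ v∈φ) = occursF

  rd-untouched : (W : List ℕ) (F : MCS D) → rd D (untouched W F) + weightIn W F ≤ rd D F
  rd-untouched W F = begin
    rd D F' + weightIn W F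
      ≡⟨ cong₂ _+_ (rd≡sumWhere F' N (occurs⇒<bound F F' F'≤F))
                   (sumWhere-cong D _ _ (upTo N) (λ v _ → fresh v)) ⟩
    sumWhere D (occurs F') (upTo N) + sumWhere D (λ v → not (occurs F' v) ∧ inW v) (upTo N)
      ≡⟨ sym (sumWhere-∨ D (occurs F') inW (upTo N)) ⟩
    sumWhere D (λ v → occurs F' v ∨ inW v) (upTo N)
      ≤⟨ sumWhere-mono D _ (occurs F) (upTo N) (λ v _ → occursF v) ⟩
    sumWhere D (occurs F) (upTo N)
      ≡⟨ sym (rd≡sumWhere F N (occurs⇒<bound F F (≤ₘ-refl {F}))) ⟩
    rd D F ∎
    where
    open ≤-Reasoning
    F' = untouched W F
    N = bound F
    F'≤F = filterᵇ-≤ₘ (not ∘ touching W) F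
    inW : ℕ → Bool
    inW v = memᵇ D v W ∧ occurs F v
    fresh : ∀ v → inW v ≡ not (occurs F' v) ∧ inW v
    fresh v with occurs F' v in occF'
    ... | false = refl
    ... | true with memᵇ D v W in v∈W
    ...   | false = refl
    ...   | true with C , C∈F' , v∈C ← occurs⇒∈ F' v occF'
                 with () ← trans (sym (proj₂ (∈-filterᵇ⁻ _ F C∈F'))) (cong not (∃⇒any _ (varFM D C) v∈C v∈W))
    occursF : ∀ v → (occurs F' v ∨ inW v) ≡ true → occurs F v ≡ true
    occursF v h with occurs F' v in occF'
    ... | true = occurs-mono F' F v F'≤F occF'
    ... | false with memᵇ D v W
    ...   | true = h

  untouched-proper : (W : List ℕ) (F : MCS D) {v : ℕ} → v ∈ W → v ∈ var D F → ¬ _≈ₘ_ D (untouched W F) F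
  untouched-proper W F {v} v∈W v∈F F'≈F with C , C∈F , v∈C ← occurs⇒∈ F v (∈-var⁻ F v v∈F)
    with C∈F' ← mult-positive⇒∈ (untouched W F) (subst (1 ≤_) (sym (F'≈F C)) (∈⇒mult-positive F C∈F))
    with () ← trans (sym (proj₂ (∈-filterᵇ⁻ _ F C∈F'))) (cong not (∃⇒any _ (varFM D C) v∈C (∈⇒memᵇ v W v∈W)))

  autarky⇒δ-≤-untouched : (φ : PAss D) (F : MCS D) → MatchingAutarky D φ F →
    δ D F ℤ.≤ δ D (untouched (varFM D φ) F)
  autarky⇒δ-≤-untouched φ F aut = [+a]-[+b]≤[+c]-[+d] (length F) (rd D F) (length F') (rd D F') (begin
    length F + rd D F'                    ≡⟨ cong (_+ rd D F') (sym (length-filterᵇ-not (touching W) F)) ⟩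
    length R + length F' + rd D F'        ≡⟨ trans (+-assoc (length R) _ _) (x∙yz≈y∙xz (length R) (length F') (rd D F')) ⟩
    length F' + (length R + rd D F')      ≤⟨ +-monoʳ-≤ (length F') (+-monoˡ-≤ (rd D F') R≤weight) ⟩
    length F' + (weightIn W F + rd D F')  ≤⟨ +-monoʳ-≤ (length F') (subst (_≤ rd D F) (+-comm (rd D F') _) (rd-untouched W F)) ⟩
    length F' + rd D F                    ∎)
    where
    open ≤-Reasoning
    W = varFM D φ
    R = restrict D φ F
    F' = untouched W F
    R≤weight : length R ≤ weightIn W F
    R≤weight = matchingSatisfying⇒length-≤ φ F R (filterᵇ-≤ₘ (touching W) F) aut

  ProperSubsLowerδ⇒MatchingLean : (F : MCS D) → ProperSubsLowerδ F → MatchingLean D F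
  ProperSubsLowerδ⇒MatchingLean F lower (φ , aut , _ , v∈φ , v∈F) = ℤ.<⇒≱
    (lower (untouched (varFM D φ) F) (filterᵇ-≤ₘ _ F) (untouched-proper (varFM D φ) F v∈φ v∈F))
    (autarky⇒δ-≤-untouched φ F aut)

  -- Matching leanness implies (3)

  newVar : MCS D → MCS D → ℕ → Bool
  newVar F G v = occurs F v ∧ not (occurs G v)

  newWeight : MCS D → MCS D → MCS D → ℕ
  newWeight F G S = sumWhere D (λ v → newVar F G v ∧ occurs S v) (upTo (bound F))

  HallForNew : MCS D → MCS D → Set
  HallForNew F G = ∀ {S} → S ⊆ F ∖ₘ G → length S ≤ newWeight F G S

  ∖ₘ-≤ₘ : (F G : MCS D) → _≤ₘ_ D (F ∖ₘ G) F
  ∖ₘ-≤ₘ F G C = subst (_≤ mult D F C) (sym (mult-∖ₘ F G C)) (m∸n≤m (mult D F C) (mult D G C))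

  ∈-∖ₘ⁺ : (F G : MCS D) {C : Clause D} → mult D G C < mult D F C → C ∈ F ∖ₘ G
  ∈-∖ₘ⁺ F G {C} G<F = mult-positive⇒∈ (F ∖ₘ G) (subst (1 ≤_) (sym (mult-∖ₘ F G C)) (m<n⇒0<n∸m G<F))

  ++-∖ₘ-≤ₘ : (F G S : MCS D) → _≤ₘ_ D G F → _≤ₘ_ D S (F ∖ₘ G) → _≤ₘ_ D (G ++ S) F
  ++-∖ₘ-≤ₘ F G S G≤F S≤F∖G C = begin
    mult D (G ++ S) C                    ≡⟨ mult-++ G S C ⟩
    mult D G C + mult D S C              ≤⟨ +-monoʳ-≤ (mult D G C) (subst (mult D S C ≤_) (mult-∖ₘ F G C) (S≤F∖G C)) ⟩
    mult D G C + (mult D F C ∸ mult D G C) ≡⟨ m+[n∸m]≡n (G≤F C) ⟩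
    mult D F C                           ∎
    where open ≤-Reasoning

  rd-++-new : (F G S : MCS D) → _≤ₘ_ D G F → _≤ₘ_ D S F → rd D (G ++ S) ≡ rd D G + newWeight F G S
  rd-++-new F G S G≤F S≤F = begin
    rd D (G ++ S)                                                 ≡⟨ rd≡sumWhere (G ++ S) N below ⟩
    sumWhere D (occurs (G ++ S)) (upTo N)                         ≡⟨ sumWhere-cong D _ _ (upTo N) (λ v _ → occurs-++ G S v) ⟩
    sumWhere D (λ v → occurs G v ∨ occurs S v) (upTo N)           ≡⟨ sumWhere-∨ D (occurs G) (occurs S) (upTo N) ⟩
    sumWhere D (occurs G) (upTo N) + sumWhere D (λ v → not (occurs G v) ∧ occurs S v) (upTo N)
      ≡⟨ cong₂ _+_ (sym (rd≡sumWhere G N (occurs⇒<bound F G G≤F))) (sumWhere-cong D _ _ (upTo N) (λ v _ → new v)) ⟩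
    rd D G + newWeight F G S                                      ∎
    where
    open ≡-Reasoning
    N = bound F
    below : ∀ v → occurs (G ++ S) v ≡ true → v < N
    below v h with occurs G v in inG | trans (sym (occurs-++ G S v)) h
    ... | true | _ = occurs⇒<bound F G G≤F v inG
    ... | false | inS = occurs⇒<bound F S S≤F v inS
    new : ∀ v → (not (occurs G v) ∧ occurs S v) ≡ (newVar F G v ∧ occurs S v)
    new v with occurs S v in inS
    ... | false = trans (∧-zeroʳ _) (sym (∧-zeroʳ _))
    ... | true rewrite occurs-mono S F v S≤F inS = refl

  δ-<-extend : (F G S : MCS D) → _≤ₘ_ D G F → S ⊆ F ∖ₘ G → newWeight F G S < length S →
    δ D G ℤ.< δ D (G ++ S)
  δ-<-extend F G S G≤F S⊆F∖G violated = [+a]-[+b]<[+c]-[+d] (length G) (rd D G) (length (G ++ S)) (rd D (G ++ S)) (begin-strict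
    length G + rd D (G ++ S)                 ≡⟨ cong (length G +_) (trans (rd-++-new F G S G≤F S≤F) (+-comm (rd D G) _)) ⟩
    length G + (newWeight F G S + rd D G)    <⟨ +-monoʳ-< (length G) (+-monoˡ-< (rd D G) violated) ⟩
    length G + (length S + rd D G)           ≡⟨ sym (trans (cong (_+ rd D G) (length-++ G)) (+-assoc (length G) _ _)) ⟩
    length (G ++ S) + rd D G                 ∎)
    where
    open ≤-Reasoning
    S≤F : _≤ₘ_ D S F
    S≤F = ≤ₘ-trans {S} {F ∖ₘ G} {F} (⊆⇒≤ₘ S⊆F∖G) (∖ₘ-≤ₘ F G)

  valueAt : List (ℕ × ℕ) → ℕ → ℕ
  valueAt [] v = 0
  valueAt ((w , a) ∷ xs) v = if w ≡ᵇ v then a else valueAt xs v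

  valueAt-∈ : (xs : List (ℕ × ℕ)) {v : ℕ} → v ∈ map proj₁ xs → (v , valueAt xs v) ∈ xs
  valueAt-∈ ((w , a) ∷ xs) {v} v∈ with w ≡ᵇ v in eq
  ... | true rewrite ≡ᵇ⇒≡ w v (Equivalence.from T-≡ eq) = here refl
  valueAt-∈ ((w , a) ∷ xs) (here refl) | false with () ← trans (sym (≡ᵇ-refl w)) eq
  valueAt-∈ ((w , a) ∷ xs) (there v∈) | false = there (valueAt-∈ xs v∈)

  valuesAt : MCS D → List (ℕ × ℕ) → ℕ → List ℕ
  valuesAt (C ∷ L) (n ∷ ns) v = if proj₁ n ≡ᵇ v then valueAt (lits C) v ∷ valuesAt L ns v else valuesAt L ns v
  valuesAt _ _ _ = []

  length-valuesAt : (L : MCS D) (ns : List (ℕ × ℕ)) (v : ℕ) →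
    length (valuesAt L ns v) ≤ length (filterᵇ (λ n → proj₁ n ≡ᵇ v) ns)
  length-valuesAt [] _ v = z≤n
  length-valuesAt (C ∷ L) [] v = z≤n
  length-valuesAt (C ∷ L) (n ∷ ns) v with proj₁ n ≡ᵇ v
  ... | true = s≤s (length-valuesAt L ns v)
  ... | false = length-valuesAt L ns v

  wfᵇ-map : (a : ℕ → ℕ) → (∀ v → a v ≤ D v) → {vs : List ℕ} → AllPairs _<_ vs →
    T (wfᵇ D (map (λ v → v , a v) vs))
  wfᵇ-map a a≤D {[]} _ = _
  wfᵇ-map a a≤D {v ∷ []} _ = <⇒<ᵇ (s≤s (a≤D v))
  wfᵇ-map a a≤D {v ∷ w ∷ vs} ((v<w ∷ _) ∷ sorted) =
    Equivalence.from T-∧ (<⇒<ᵇ (s≤s (a≤D v)) , Equivalence.from T-∧ (<⇒<ᵇ v<w , wfᵇ-map a a≤D sorted))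

  module AutarkyFromHall (F G : MCS D) (G≤F : _≤ₘ_ D G F) (G≉F : ¬ _≈ₘ_ D G F) (hallNew : HallForNew F G) where

    N : ℕ
    N = bound F

    W : List ℕ
    W = filterᵇ (newVar F G) (upTo N)

    L : MCS D
    L = filterᵇ (touching W) F

    open Hall (×.≡-dec _≟_ _≟_) (λ C n → memᵇ D (proj₁ n) (varFM D C))

    adjacent≡occurs : (T : MCS D) (n : ℕ × ℕ) → adjacent T n ≡ occurs T (proj₁ n)
    adjacent≡occurs [] n = refl
    adjacent≡occurs (C ∷ T) n = cong (memᵇ D (proj₁ n) (varFM D C) ∨_) (adjacent≡occurs T n)

    L≤F∖G : _≤ₘ_ D L (F ∖ₘ G)
    L≤F∖G C with touching W C in touches
    ... | false with mult D L C in eq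
    ...   | zero = z≤n
    ...   | suc _ with () ← trans (sym touches) (proj₂ (∈-filterᵇ⁻ _ F (mult-positive⇒∈ L (subst (1 ≤_) (sym eq) (s≤s z≤n)))))
    L≤F∖G C | true = subst (mult D L C ≤_) (sym (trans (mult-∖ₘ F G C) (cong (mult D F C ∸_) C∉G))) (filterᵇ-≤ₘ _ F C)
      where
      C∉G : mult D G C ≡ 0
      C∉G with mult D G C in eq
      ... | zero = refl
      ... | suc _ with v , v∈C , v∈W ← any⇒∃ _ (varFM D C) touches
                  with () ← trans (sym (cong not (∈⇒occurs G v (mult-positive⇒∈ G (subst (1 ≤_) (sym eq) (s≤s z≤n))) v∈C)))
                                  (∧-conicalʳ _ _ (proj₂ (∈-filterᵇ⁻ (newVar F G) (upTo N) (memᵇ⇒∈ v W v∈W))))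

    hallL : HallCondition (varNodes W) L
    hallL {T} T⊆L with T' , T'⊆F∖G , T'≈T , ∣T'∣≡∣T∣ ← ≤ₘ⇒⊆ (F ∖ₘ G) T (≤ₘ-trans {T} {L} {F ∖ₘ G} (⊆⇒≤ₘ T⊆L) L≤F∖G) = begin
      length T                                ≡⟨ sym ∣T'∣≡∣T∣ ⟩
      length T'                               ≤⟨ hallNew T'⊆F∖G ⟩
      newWeight F G T'                        ≡⟨ sumWhere-cong D _ _ (upTo N) (λ v _ → cong (newVar F G v ∧_) (occurs-cong T' T v T'≈T)) ⟩
      newWeight F G T                         ≡⟨ sym (sumWhere-filterᵇ D (newVar F G) (occurs T) (upTo N)) ⟩
      sumWhere D (occurs T) W                 ≡⟨ sym (count-varNodes (occurs T) W) ⟩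
      count (occurs T ∘ proj₁) (varNodes W)   ≡⟨ sumWhere-cong _ _ _ (varNodes W) (λ n _ → sym (adjacent≡occurs T n)) ⟩
      neighbours (varNodes W) T               ∎
      where open ≤-Reasoning

    W! : Unique W
    W! = Unique.filter⁺ (T? ∘ newVar F G) (Unique.upTo⁺ N)

    matched : Matchable (varNodes W) L
    matched = hall-theorem (Unique-varNodes W!) hallL

    ns : List (ℕ × ℕ)
    ns = proj₁ matched

    matching : Matching (varNodes W) L ns
    matching = proj₁ (proj₂ matched)

    length-valuesAt-≤ : (v : ℕ) → length (valuesAt L ns v) ≤ D v
    length-valuesAt-≤ v = ≤-trans (length-valuesAt L ns v) (begin
      length (filterᵇ (λ n → proj₁ n ≡ᵇ v) ns) ≤⟨ Unique-length-mono (Unique.filter⁺ (T? ∘ (λ n → proj₁ n ≡ᵇ v)) (proj₂ (proj₂ matched))) at-v⊆nodes ⟩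
      length (nodesOf v)                        ≡⟨ length-nodesOf v ⟩
      D v                                       ∎)
      where
      open ≤-Reasoning
      at-v⊆nodes : ∀ {n} → n ∈ filterᵇ (λ n → proj₁ n ≡ᵇ v) ns → n ∈ nodesOf v
      at-v⊆nodes {w , j} n∈ with n∈ns , w≡ᵇv ← ∈-filterᵇ⁻ _ ns n∈
                            with refl ← ≡ᵇ⇒≡ w v (Equivalence.from T-≡ w≡ᵇv)
                            with _ , 1≤j , j≤Dw ← ∈-varNodes⁻ W (Matching-∈ matching n∈ns) = ∈-nodesOf⁺ 1≤j j≤Dw

    -- At most D v clauses are matched to nodes of v, so one of the D v + 1 values of v
    -- satisfies all their literals on v.
    value : ℕ → ℕ
    value v = proj₁ (unused-value (D v) (valuesAt L ns v) (length-valuesAt-≤ v))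

    φ : PAss D
    φ = mk (map (λ v → v , value v) W)
           (wfᵇ-map value (λ v → proj₁ (proj₂ (unused-value (D v) (valuesAt L ns v) (length-valuesAt-≤ v))))
                    (AllPairs.filter⁺ (T? ∘ newVar F G) (AllPairs.applyUpTo⁺₁ (λ v → v) N (λ i<j _ → i<j))))

    varFM-φ : varFM D φ ≡ W
    varFM-φ = trans (sym (map-∘ W)) (map-id W)

    valueAt-matched : {L' : MCS D} {ns' : List (ℕ × ℕ)} (m : Matching (varNodes W) L' ns') (i : Fin (length L')) →
      valueAt (lits (lookup L' i)) (proj₁ (matchingAt m i)) ∈ valuesAt L' ns' (proj₁ (matchingAt m i))
    valueAt-matched (_∷_ {y = n} _ _) Fin.zero rewrite ≡ᵇ-refl (proj₁ n) = here refl
    valueAt-matched (_∷_ {y = n} _ m) (Fin.suc i) with proj₁ n ≡ᵇ proj₁ (matchingAt m i)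
    ... | true = there (valueAt-matched m i)
    ... | false = valueAt-matched m i

    satisfying : MatchingSatisfying D φ L
    satisfying = matchingAt matching , matchingAt-injective matching (proj₂ (proj₂ matched)) , edge
      where
      edge : ∀ i → Edgeφ D φ (lookup L i) (matchingAt matching i)
      edge i = 1≤j , j≤Dv , value v , valueAt (lits C) v ,
               ∈-map⁺ (λ v → v , value v) v∈W , valueAt-∈ (lits C) (memᵇ⇒∈ v _ (matchingAt-edge matching i)) ,
               λ a≡b → proj₂ (proj₂ (unused-value (D v) (valuesAt L ns v) (length-valuesAt-≤ v)))
                         (subst (_∈ valuesAt L ns v) (sym a≡b) (valueAt-matched matching i))
        where
        C = lookup L i
        v = proj₁ (matchingAt matching i)
        node = ∈-varNodes⁻ W (Matching-∈ matching (matchingAt-∈ matching i))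
        v∈W = proj₁ node
        1≤j = proj₁ (proj₂ node)
        j≤Dv = proj₂ (proj₂ node)

    nonTrivial : NonTrivial D φ F
    nonTrivial = v , subst (v ∈_) (sym varFM-φ) (∈-filterᵇ⁺ (newVar F G) (upTo N) v∈N newv) , ∈-var⁺ F v (∧-conicalˡ _ _ newv)
      where
      C∈F∖G = let _ , _ , G<F = proper⇒mult-< F G G≤F G≉F in ∈-∖ₘ⁺ F G G<F
      witness = sumWhere-positive D _ (upTo N) (hallNew (from∈ C∈F∖G))
      v = proj₁ witness
      v∈N = proj₁ (proj₂ witness)
      newv = ∧-conicalˡ _ _ (proj₁ (proj₂ (proj₂ witness)))

    autarky : ∃[ φ ] (MatchingAutarky D φ F × NonTrivial D φ F)
    autarky = φ , subst (MatchingSatisfying D φ) (cong (λ X → filterᵇ (touching X) F) (sym varFM-φ)) satisfying , nonTrivial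

  -- The fuel k bounds the number of extensions of G, which grows inside F.
  autarky-by-extension : (F : MCS D) (k : ℕ) (G : MCS D) → _≤ₘ_ D G F → ¬ _≈ₘ_ D G F →
    δ D F ℤ.≤ δ D G → length F ≤ length G + k → ∃[ φ ] (MatchingAutarky D φ F × NonTrivial D φ F)
  autarky-by-extension F k G G≤F G≉F δF≤δG ∣F∣≤
    with ∃-sublist? (λ S → newWeight F G S < length S) (λ S → newWeight F G S <? length S) (F ∖ₘ G)
  ... | no ¬violated = AutarkyFromHall.autarky F G G≤F G≉F (λ {S} S⊆ → ≮⇒≥ (λ violated → ¬violated (S , S⊆ , violated)))
  ... | yes (S , S⊆F∖G , violated) = continue k ∣F∣≤
    where
    G' = G ++ S
    G'≤F : _≤ₘ_ D G' F
    G'≤F = ++-∖ₘ-≤ₘ F G S G≤F (⊆⇒≤ₘ S⊆F∖G)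
    δF<δG' : δ D F ℤ.< δ D G'
    δF<δG' = ℤ.≤-<-trans δF≤δG (δ-<-extend F G S G≤F S⊆F∖G violated)
    G'≉F : ¬ _≈ₘ_ D G' F
    G'≉F G'≈F = ℤ.<⇒≢ δF<δG' (sym (δ-cong G' F G'≈F))
    ∣G∣<∣G'∣ : length G < length G'
    ∣G∣<∣G'∣ = subst (length G <_) (sym (length-++ G)) (m<m+n (length G) (≤-<-trans z≤n violated))
    continue : ∀ k → length F ≤ length G + k → ∃[ φ ] (MatchingAutarky D φ F × NonTrivial D φ F)
    continue zero ∣F∣≤∣G∣+0 = ⊥-elim (<⇒≱ ∣G∣<∣G'∣
      (≤-trans (length-mono-≤ₘ G' F G'≤F) (subst (length F ≤_) (+-identityʳ (length G)) ∣F∣≤∣G∣+0)))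
    continue (suc k) ∣F∣≤ = autarky-by-extension F k G' G'≤F G'≉F (ℤ.<⇒≤ δF<δG') (begin
      length F            ≤⟨ ∣F∣≤ ⟩
      length G + suc k    ≡⟨ +-suc (length G) k ⟩
      suc (length G) + k  ≤⟨ +-monoˡ-≤ k ∣G∣<∣G'∣ ⟩
      length G' + k       ∎)
      where open ≤-Reasoning

  MatchingLean⇒ProperSubsLowerδ : (F : MCS D) → MatchingLean D F → ProperSubsLowerδ F
  MatchingLean⇒ProperSubsLowerδ F lean F' F'≤F F'≉F with δ D F' ℤ.<? δ D F
  ... | yes δF'<δF = δF'<δF
  ... | no δF'≮δF = ⊥-elim (lean (autarky-by-extension F (length F) F' F'≤F F'≉F (ℤ.≮⇒≥ δF'≮δF) (m≤n+m (length F) (length F'))))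

lemma1p9p4 : (D : ℕ → ℕ) (F : MCS D) →
    (MatchingLean D F ⇔ (∀ C → C ∈ F → δ* D (remove1 D C F) ℤ.< δ* D F))
    × (MatchingLean D F ⇔ (∀ F' → _≤ₘ_ D F' F → ¬ _≈ₘ_ D F' F → δ D F' ℤ.< δ D F))
    × (MatchingLean D F ⇔
        (Tight D F F × (∀ F' → Tight D F F' → _≈ₘ_ D F' F)))
lemma1p9p4 D F =
  mk⇔ (ProperSubsLowerδ⇒RemovalLowersδ* F ∘ lean⇒) (lean⇐ ∘ RemovalLowersδ*⇒ProperSubsLowerδ F) ,
  mk⇔ lean⇒ lean⇐ ,
  mk⇔ (ProperSubsLowerδ⇒UniquelyTight F ∘ lean⇒) (lean⇐ ∘ UniquelyTight⇒ProperSubsLowerδ F)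
  where
  open Leanness D
  lean⇒ : MatchingLean D F → ProperSubsLowerδ F
  lean⇒ = MatchingLean⇒ProperSubsLowerδ F
  lean⇐ : ProperSubsLowerδ F → MatchingLean D F
  lean⇐ = ProperSubsLowerδ⇒MatchingLean F
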